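{- Let $t\ge 1$ be an integer and let $H$ be a graph. If the class of $H$-free graphs is Pollyanna, then the class of $(K_t\cup H)$-free graphs is Pollyanna.
   Context: $K_t\cup H$ denotes the disjoint union of the complete graph $K_t$ and $H$. A graph is $H$-free if it has no induced subgraph isomorphic to $H$. A class $\mathcal F$ of graphs is $\chi$-bounded (resp. polynomially $\chi$-bounded) if there is a function (resp. polynomial) $f$ with $\chi(G')\le f(\omega(G'))$ for every induced subgraph $G'$ of every graph in $\mathcal F$. A class $\mathcal C$ is Pollyanna if $\mathcal C\cap\mathcal F$ is polynomially $\chi$-bounded for every $\chi$-bounded class $\mathcal F$. -}

module Defs where

open import Data.Nat using (ℕ; zero; suc; _+_; _*_; _^_; _≤_)
open import Data.Fin using (Fin; splitAt; _≟_)
open import Data.Bool using (Bool; true; false; not)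
open import Data.Sum using (_⊎_; inj₁; inj₂)
open import Data.Product using (Σ; _×_; _,_; ∃)
open import Data.List using (List; []; _∷_)
open import Data.Empty using (⊥)
open import Relation.Nullary using (¬_; does; yes; no)
open import Relation.Binary.PropositionalEquality using (_≡_; _≢_; refl; sym)
open import Function.Definitions using (Injective)

record Graph : Set where
  field
    n     : ℕ
    adj   : Fin n → Fin n → Bool
    adj-sym : ∀ i j → adj i j ≡ adj j i
    irrefl : ∀ i → adj i i ≡ false
open Graph public

_≤ind_ : Graph → Graph → Set
H ≤ind G = Σ (Fin (n H) → Fin (n G)) λ f →
  Injective _≡_ _≡_ f × (∀ i j → adj H i j ≡ adj G (f i) (f j))

Free : Graph → Graph → Set
Free H G = ¬ (H ≤ind G)

private
  neq : ∀ {t} → Fin t → Fin t → Bool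
  neq i j = not (does (i ≟ j))

  neq-sym : ∀ {t} (i j : Fin t) → neq i j ≡ neq j i
  neq-sym i j with i ≟ j | j ≟ i
  ... | yes _ | yes _ = refl
  ... | no _  | no _  = refl
  ... | yes p | no q  with q (sym p)
  ... | ()
  neq-sym i j | no q | yes p with q (sym p)
  ... | ()

  neq-irr : ∀ {t} (i : Fin t) → neq i i ≡ false
  neq-irr i with i ≟ i
  ... | yes _ = refl
  ... | no q with q refl
  ... | ()

K : ℕ → Graph
K t = record { n = t ; adj = neq ; adj-sym = neq-sym ; irrefl = neq-irr }

-- Disjoint union of two graphs (vertices of G first, then H).
private
  adjSum : (G H : Graph) → Fin (n G) ⊎ Fin (n H) → Fin (n G) ⊎ Fin (n H) → Bool
  adjSum G H (inj₁ i) (inj₁ j) = adj G i j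
  adjSum G H (inj₂ i) (inj₂ j) = adj H i j
  adjSum G H (inj₁ _) (inj₂ _) = false
  adjSum G H (inj₂ _) (inj₁ _) = false

  adjSum-sym : (G H : Graph) → ∀ x y → adjSum G H x y ≡ adjSum G H y x
  adjSum-sym G H (inj₁ i) (inj₁ j) = adj-sym G i j
  adjSum-sym G H (inj₂ i) (inj₂ j) = adj-sym H i j
  adjSum-sym G H (inj₁ _) (inj₂ _) = refl
  adjSum-sym G H (inj₂ _) (inj₁ _) = refl

  adjSum-irr : (G H : Graph) → ∀ x → adjSum G H x x ≡ false
  adjSum-irr G H (inj₁ i) = irrefl G i
  adjSum-irr G H (inj₂ i) = irrefl H i

_∪ᴳ_ : Graph → Graph → Graph
G ∪ᴳ H = record
  { n = n G + n H
  ; adj = λ i j → adjSum G H (splitAt (n G) i) (splitAt (n G) j)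
  ; adj-sym = λ i j → adjSum-sym G H (splitAt (n G) i) (splitAt (n G) j)
  ; irrefl = λ i → adjSum-irr G H (splitAt (n G) i)
  }

HasClique : Graph → ℕ → Set
HasClique G k = Σ (Fin k → Fin (n G)) λ f →
  Injective _≡_ _≡_ f × (∀ i j → i ≢ j → adj G (f i) (f j) ≡ true)

IsCliqueNumber : Graph → ℕ → Set
IsCliqueNumber G w = HasClique G w × ¬ HasClique G (suc w)

Colorable : Graph → ℕ → Set
Colorable G k = Σ (Fin (n G) → Fin k) λ c →
  ∀ i j → adj G i j ≡ true → c i ≢ c j

ChiLeq : Graph → (ℕ → ℕ) → Set
ChiLeq G f = ∀ w → IsCliqueNumber G w → Colorable G (f w)

Class : Set₁
Class = Graph → Set

BoundedBy : Class → (ℕ → ℕ) → Set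
BoundedBy 𝓕 f = ∀ G → 𝓕 G → ∀ G' → G' ≤ind G → ChiLeq G' f

ChiBounded : Class → Set
ChiBounded 𝓕 = Σ (ℕ → ℕ) λ f → BoundedBy 𝓕 f

-- Polynomials with natural-number coefficients (constant term first).
Poly : Set
Poly = List ℕ

eval : Poly → ℕ → ℕ
eval []       x = 0
eval (a ∷ as) x = a + x * eval as x

PolyChiBounded : Class → Set
PolyChiBounded 𝓕 = Σ Poly λ p → BoundedBy 𝓕 (eval p)

_∩_ : Class → Class → Class
(𝓒 ∩ 𝓕) G = 𝓒 G × 𝓕 G

Pollyanna : Class → Set₁
Pollyanna 𝓒 = (𝓕 : Class) → ChiBounded 𝓕 → PolyChiBounded (𝓒 ∩ 𝓕)

-- Let G be (K_t ∪ H)-free with a maximum clique Q of size w, and look at where each vertex x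
-- sees Q. Either x has t non-neighbours in Q other than itself, or all its non-neighbours in Q
-- lie in a set of t + 1 indices. Group the vertices by these t or t + 1 indices: at most
-- w^t + w^(t+1) groups. A group of the first kind is anticomplete to a common K_t, so it is
-- H-free and χ ≤ p(ω) there, by the Pollyanna property of the H-free graphs applied to the
-- hereditary closure of the χ-bounded class. A group of the second kind has ω ≤ t + 1: a larger
-- clique, together with the part of Q it is complete to, would be a clique larger than Q.
-- Coloring each group with its own palette bounds χ(G) by a polynomial in w.
module Submission where

open import Defs
open import Data.Nat using (ℕ; zero; suc; _+_; _*_; _^_; _≤_; _⊔_; z≤n; s≤s)
import Data.Nat.Properties as ℕ
open import Data.Nat.Tactic.RingSolver using (solve-∀)
open import Data.Fin as Fin
  using (Fin; zero; suc; splitAt; join; combine; inject≤; inject₁; fromℕ; punchIn; funToFin; finToFun)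
import Data.Fin.Properties as Finₚ
import Data.Bool.Properties as Bool
open import Data.Bool using (true; false)
open import Data.Sum using (_⊎_; inj₁; inj₂; [_,_]′)
open import Data.Product using (_×_; _,_; ∃; proj₁; proj₂)
open import Data.List using (List; []; _∷_; filter; allFin; length; lookup)
open import Data.List.Membership.Propositional.Properties
  using (∈-lookup; ∈-filter⁺; ∈-filter⁻; ∈-allFin)
open import Data.List.Relation.Unary.Any using (index)
open import Data.List.Relation.Unary.Any.Properties using (lookup-index)
import Data.List.Relation.Unary.All as All
open import Data.List.Relation.Unary.AllPairs using (_∷_)
open import Data.List.Relation.Unary.Unique.Propositional using (Unique)
open import Data.List.Relation.Unary.Unique.Propositional.Properties using (filter⁺; allFin⁺)
import Data.Vec.Functional as Vector
open import Data.Empty using (⊥-elim)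
open import Relation.Nullary using (¬_; Dec; yes; no; contradiction; map′; _×-dec_; _→-dec_; ¬?)
open import Relation.Unary using (Decidable)
open import Relation.Binary.PropositionalEquality
open import Function using (_∘_)
open import Function.Definitions using (Injective)

induced : (G : Graph) {m : ℕ} → (Fin m → Fin (n G)) → Graph
induced G {m} e = record
  { n = m
  ; adj = λ i j → adj G (e i) (e j)
  ; adj-sym = λ i j → adj-sym G (e i) (e j)
  ; irrefl = λ i → irrefl G (e i)
  }

induced-≤ind : (G : Graph) {m : ℕ} {e : Fin m → Fin (n G)} →
  Injective _≡_ _≡_ e → induced G e ≤ind G
induced-≤ind G {e = e} e-inj = e , e-inj , λ _ _ → refl

≤ind-refl : {G : Graph} → G ≤ind G
≤ind-refl = (λ x → x) , (λ eq → eq) , λ _ _ → refl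

≤ind-trans : {A B C : Graph} → A ≤ind B → B ≤ind C → A ≤ind C
≤ind-trans (f , f-inj , f-adj) (g , g-inj , g-adj) =
  g ∘ f , f-inj ∘ g-inj , λ i j → trans (f-adj i j) (g-adj (f i) (f j))

Colorable-mono : (G : Graph) {k l : ℕ} → k ≤ l → Colorable G k → Colorable G l
Colorable-mono G k≤l (c , proper) =
  (λ x → inject≤ (c x) k≤l) ,
  λ i j ij → proper i j ij ∘ Finₚ.inject≤-injective k≤l k≤l (c i) (c j)

Colorable-empty : (G : Graph) {k : ℕ} → ¬ Fin (n G) → Colorable G k
Colorable-empty G no-vertex = (λ x → ⊥-elim (no-vertex x)) , λ i → ⊥-elim (no-vertex i)

inhabited-or-empty : (m : ℕ) → Fin m ⊎ ¬ Fin m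
inhabited-or-empty zero = inj₂ λ ()
inhabited-or-empty (suc m) = inj₁ zero

Colorable-if-inhabited : (G : Graph) {k : ℕ} → (Fin (n G) → Colorable G k) → Colorable G k
Colorable-if-inhabited G col = [ col , Colorable-empty G ]′ (inhabited-or-empty (n G))

-- Embedding K_t ∪ H

K-≤ind : (G : Graph) {t : ℕ} → HasClique G t → K t ≤ind G
K-≤ind G {t} (q , q-inj , q-clique) = q , q-inj , adj-q
  where
  adj-q : ∀ i j → adj (K t) i j ≡ adj G (q i) (q j)
  adj-q i j with i Fin.≟ j
  ... | yes refl = sym (irrefl G (q i))
  ... | no i≢j = sym (q-clique i j i≢j)

∪ᴳ-≤ind : {A B G : Graph} (α : A ≤ind G) (β : B ≤ind G) →
  (∀ a b → proj₁ α a ≢ proj₁ β b) →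
  (∀ a b → adj G (proj₁ α a) (proj₁ β b) ≡ false) →
  (A ∪ᴳ B) ≤ind G
∪ᴳ-≤ind {A} {B} {G} (f , f-inj , f-adj) (g , g-inj , g-adj) disjoint anticomplete =
  [ f , g ]′ ∘ split , injective , adjacency
  where
  split = splitAt (n A)
  unsplit = join (n A) (n B)

  [f,g]-injective : ∀ s s' → [ f , g ]′ s ≡ [ f , g ]′ s' → s ≡ s'
  [f,g]-injective (inj₁ a) (inj₁ a') eq = cong inj₁ (f-inj eq)
  [f,g]-injective (inj₁ a) (inj₂ b) eq = contradiction eq (disjoint a b)
  [f,g]-injective (inj₂ b) (inj₁ a) eq = contradiction (sym eq) (disjoint a b)
  [f,g]-injective (inj₂ b) (inj₂ b') eq = cong inj₂ (g-inj eq)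

  injective : Injective _≡_ _≡_ ([ f , g ]′ ∘ split)
  injective {i} {j} eq = begin
    i                   ≡⟨ Finₚ.join-splitAt (n A) (n B) i ⟨
    unsplit (split i)   ≡⟨ cong unsplit ([f,g]-injective (split i) (split j) eq) ⟩
    unsplit (split j)   ≡⟨ Finₚ.join-splitAt (n A) (n B) j ⟩
    j                   ∎
    where open ≡-Reasoning

  adjacency : ∀ i j → adj (A ∪ᴳ B) i j ≡ adj G ([ f , g ]′ (split i)) ([ f , g ]′ (split j))
  adjacency i j with split i | split j
  ... | inj₁ a | inj₁ a' = f-adj a a'
  ... | inj₁ a | inj₂ b = sym (anticomplete a b)
  ... | inj₂ b | inj₁ a = sym (trans (adj-sym G (g b) (f a)) (anticomplete a b))
  ... | inj₂ b | inj₂ b' = g-adj b b'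

Free-beside-clique : {t : ℕ} {H G : Graph} {m : ℕ} {e : Fin m → Fin (n G)} →
  Injective _≡_ _≡_ e → (q : HasClique G t) →
  (∀ i x → proj₁ q i ≢ e x) → (∀ i x → adj G (proj₁ q i) (e x) ≡ false) →
  Free (K t ∪ᴳ H) G → Free H (induced G e)
Free-beside-clique {t} {H} {G} {e = e} e-inj q disjoint anticomplete free H≤S =
  free (∪ᴳ-≤ind {K t} {H} {G} (K-≤ind G q) H≤G
          (λ i y → disjoint i (proj₁ H≤S y))
          (λ i y → anticomplete i (proj₁ H≤S y)))
  where
  H≤G = ≤ind-trans {H} {induced G e} {G} H≤S (induced-≤ind G e-inj)

lookup-injective : {A : Set} {xs : List A} → Unique xs →
  ∀ i j → lookup xs i ≡ lookup xs j → i ≡ j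
lookup-injective (_ ∷ _) zero zero _ = refl
lookup-injective (x∉xs ∷ _) zero (suc j) eq = contradiction eq (All.lookup x∉xs (∈-lookup j))
lookup-injective (x∉xs ∷ _) (suc i) zero eq = contradiction (sym eq) (All.lookup x∉xs (∈-lookup i))
lookup-injective (_ ∷ xs-unique) (suc i) (suc j) eq = cong suc (lookup-injective xs-unique i j eq)

module Enumeration {m : ℕ} {P : Fin m → Set} (P? : Decidable P) where

  members : List (Fin m)
  members = filter P? (allFin m)

  size : ℕ
  size = length members

  member : Fin size → Fin m
  member = lookup members

  member-injective : Injective _≡_ _≡_ member
  member-injective = lookup-injective (filter⁺ P? (allFin⁺ m)) _ _

  member-satisfies : ∀ i → P (member i)
  member-satisfies i = proj₂ (∈-filter⁻ P? {xs = allFin m} (∈-lookup i))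

  member-surjective : ∀ x → P x → ∃ λ i → member i ≡ x
  member-surjective x Px = index x∈ , sym (lookup-index x∈)
    where x∈ = ∈-filter⁺ P? (∈-allFin x) Px

module Parts (G : Graph) {N : ℕ} (class : Fin (n G) → Fin N) where

  module Part (c : Fin N) = Enumeration (λ x → class x Fin.≟ c)

  part : Fin N → Graph
  part c = induced G (Part.member c)

  part-≤ind : ∀ c → part c ≤ind G
  part-≤ind c = induced-≤ind G (Part.member-injective c)

  Colorable-by-parts : {k : ℕ} → (∀ c → Colorable (part c) k) → Colorable G (N * k)
  Colorable-by-parts {k} col = color , proper
    where
    Position : Fin N → Fin (n G) → Set
    Position c x = ∃ λ i → Part.member c i ≡ x

    colorAt : ∀ {c x} → Position c x → Fin k
    colorAt {c} (i , _) = proj₁ (col c) i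

    proper-at : ∀ {c d x y} (i : Position c x) (j : Position d y) → c ≡ d →
      adj G x y ≡ true → colorAt i ≢ colorAt j
    proper-at {c} (i , refl) (j , refl) refl = proj₂ (col c) i j

    position : ∀ x → Position (class x) x
    position x = Part.member-surjective (class x) x refl

    color : Fin (n G) → Fin (N * k)
    color x = combine (class x) (colorAt (position x))

    proper : ∀ x y → adj G x y ≡ true → color x ≢ color y
    proper x y xy eq with Finₚ.combine-injective (class x) _ (class y) _ eq
    ... | same-class , same-color = proper-at (position x) (position y) same-class xy same-color

-- Cliques and clique numbers

IsClique : (G : Graph) {k : ℕ} → (Fin k → Fin (n G)) → Set
IsClique G f = Injective _≡_ _≡_ f × (∀ i j → i ≢ j → adj G (f i) (f j) ≡ true)

IsClique? : (G : Graph) {k : ℕ} (f : Fin k → Fin (n G)) → Dec (IsClique G f)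
IsClique? G f = injective? ×-dec clique?
  where
  injective? : Dec (Injective _≡_ _≡_ f)
  injective? = map′ (λ inj {x} {y} → inj x y) (λ inj x y → inj)
    (Finₚ.all? λ x → Finₚ.all? λ y → (f x Fin.≟ f y) →-dec (x Fin.≟ y))
  clique? : Dec (∀ i j → i ≢ j → adj G (f i) (f j) ≡ true)
  clique? = Finₚ.all? λ i → Finₚ.all? λ j → ¬? (i Fin.≟ j) →-dec (adj G (f i) (f j) Bool.≟ true)

IsClique-resp-≗ : (G : Graph) {k : ℕ} {f g : Fin k → Fin (n G)} →
  f ≗ g → IsClique G f → IsClique G g
IsClique-resp-≗ G {f = f} {g} f≗g (f-inj , f-clique) =
  (λ {x} {y} eq → f-inj (trans (f≗g x) (trans eq (sym (f≗g y))))) ,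
  λ i j i≢j → subst₂ (λ a b → adj G a b ≡ true) (f≗g i) (f≗g j) (f-clique i j i≢j)

IsClique-∘ : (G : Graph) {k m : ℕ} {q : Fin m → Fin (n G)} {g : Fin k → Fin m} →
  IsClique G q → Injective _≡_ _≡_ g → IsClique G (q ∘ g)
IsClique-∘ G (q-inj , q-clique) g-inj = g-inj ∘ q-inj , λ i j i≢j → q-clique _ _ (i≢j ∘ g-inj)

HasClique? : (G : Graph) (k : ℕ) → Dec (HasClique G k)
HasClique? G k = map′ (λ (i , clique) → finToFun i , clique)
  (λ (f , clique) → funToFin f , IsClique-resp-≗ G (sym ∘ Finₚ.finToFun-funToFin f) clique)
  (Finₚ.any? (IsClique? G ∘ finToFun))

HasClique-≤ : (G : Graph) {j k : ℕ} → j ≤ k → HasClique G k → HasClique G j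
HasClique-≤ G j≤k (f , f-inj , f-clique) =
  f ∘ (λ i → inject≤ i j≤k) ,
  Finₚ.inject≤-injective j≤k j≤k _ _ ∘ f-inj ,
  λ i i' i≢i' → f-clique _ _ (i≢i' ∘ Finₚ.inject≤-injective j≤k j≤k i i')

HasClique-≤ind : {S G : Graph} {k : ℕ} → S ≤ind G → HasClique S k → HasClique G k
HasClique-≤ind {S} {G} (e , e-inj , e-adj) (f , f-inj , f-clique) =
  e ∘ f , f-inj ∘ e-inj , λ i j i≢j → trans (sym (e-adj (f i) (f j))) (f-clique i j i≢j)

vertex-clique : (G : Graph) → Fin (n G) → HasClique G 1
vertex-clique G x =
  (λ _ → x) , (λ { {zero} {zero} _ → refl }) , λ { zero zero 0≢0 → contradiction refl 0≢0 }

cliqueNumber : (G : Graph) → ∃ (IsCliqueNumber G)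
cliqueNumber G = below (n G) λ (f , f-inj , _) → ℕ.<-irrefl refl (Finₚ.injective⇒≤ f-inj)
  where
  below : ∀ k → ¬ HasClique G (suc k) → ∃ (IsCliqueNumber G)
  below k no-clique with HasClique? G k
  ... | yes clique = k , clique , no-clique
  below zero no-clique | no no-empty-clique = contradiction ((λ ()) , (λ { {()} }) , λ ()) no-empty-clique
  below (suc k) no-clique | no no-smaller-clique = below k no-smaller-clique

IsCliqueNumber-≤ : (G : Graph) {ω k : ℕ} → IsCliqueNumber G ω → ¬ HasClique G (suc k) → ω ≤ k
IsCliqueNumber-≤ G (clique , _) no-clique = ℕ.≮⇒≥ λ k<ω → no-clique (HasClique-≤ G k<ω clique)

IsCliqueNumber-≤ind : {S G : Graph} {a b : ℕ} → S ≤ind G →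
  IsCliqueNumber S a → IsCliqueNumber G b → a ≤ b
IsCliqueNumber-≤ind {S} {G} S≤G ω-S (_ , no-bigger) =
  IsCliqueNumber-≤ S ω-S λ big → no-bigger (HasClique-≤ind {S} {G} S≤G big)

∷-injective : {A : Set} {k : ℕ} {a : A} {f : Fin k → A} →
  Injective _≡_ _≡_ f → (∀ i → f i ≢ a) → Injective _≡_ _≡_ (a Vector.∷ f)
∷-injective f-inj a∉f {zero} {zero} _ = refl
∷-injective f-inj a∉f {zero} {suc j} eq = contradiction (sym eq) (a∉f j)
∷-injective f-inj a∉f {suc i} {zero} eq = contradiction eq (a∉f i)
∷-injective f-inj a∉f {suc i} {suc j} eq = cong suc (f-inj eq)

IsClique-∷ : (G : Graph) {k : ℕ} {v : Fin (n G)} {f : Fin k → Fin (n G)} →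
  IsClique G f → (∀ i → f i ≢ v) → (∀ i → adj G v (f i) ≡ true) → IsClique G (v Vector.∷ f)
IsClique-∷ G {v = v} {f} (f-inj , f-clique) v∉f v-adj = ∷-injective f-inj v∉f , clique
  where
  clique : ∀ i j → i ≢ j → adj G ((v Vector.∷ f) i) ((v Vector.∷ f) j) ≡ true
  clique zero zero 0≢0 = contradiction refl 0≢0
  clique zero (suc j) _ = v-adj j
  clique (suc i) zero _ = trans (adj-sym G (f i) v) (v-adj i)
  clique (suc i) (suc j) i≢j = f-clique i j (i≢j ∘ cong suc)

Covers : {w k : ℕ} → (Fin w → Set) → (Fin k → Fin w) → Set
Covers P h = ∀ i → P i → ∃ λ l → h l ≡ i

-- The vertices c (inject₁ l) take the place of the at most k vertices q (h l) of q that some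
-- vertex of c misses; c (fromℕ k) is then one vertex more than q had.
clique-exchange : (G : Graph) {w k : ℕ} {q : Fin w → Fin (n G)} {c : Fin (suc k) → Fin (n G)} →
  IsClique G q → IsClique G c → (h : Fin k → Fin w) →
  (∀ l → Covers (λ i → adj G (c l) (q i) ≡ false) h) → HasClique G (suc w)
clique-exchange G {w} {k} {q} {c} (q-inj , q-clique) (c-inj , c-clique) h covers =
  c top Vector.∷ merged ,
  IsClique-∷ G (merged-inj , merged-clique) (λ i → top-new i (covered? i)) (λ i → top-adj i (covered? i))
  where
  top : Fin (suc k)
  top = fromℕ k

  Covered : Fin w → Set
  Covered i = ∃ λ l → h l ≡ i

  covered? : ∀ i → Dec (Covered i)
  covered? i = Finₚ.any? λ l → h l Fin.≟ i

  adjacent-outside : ∀ l {i} → ¬ Covered i → adj G (c l) (q i) ≡ true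
  adjacent-outside l {i} i∉h = Bool.¬-not λ c-non-adj → i∉h (covers l i c-non-adj)

  distinct-outside : ∀ l {i} → ¬ Covered i → c l ≢ q i
  distinct-outside l {i} i∉h c≡q =
    Bool.not-¬ (irrefl G (q i)) (subst (λ x → adj G x (q i) ≡ true) c≡q (adjacent-outside l i∉h))

  replace : ∀ i → Dec (Covered i) → Fin (n G)
  replace i (yes (l , _)) = c (inject₁ l)
  replace i (no _) = q i

  merged : Fin w → Fin (n G)
  merged i = replace i (covered? i)

  replace-injective : ∀ i i' d d' → replace i d ≡ replace i' d' → i ≡ i'
  replace-injective _ _ (yes (l , refl)) (yes (l' , refl)) eq = cong h (Finₚ.inject₁-injective (c-inj eq))
  replace-injective _ _ (yes (l , _)) (no i'∉h) eq = contradiction eq (distinct-outside (inject₁ l) i'∉h)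
  replace-injective _ _ (no i∉h) (yes (l' , _)) eq =
    contradiction (sym eq) (distinct-outside (inject₁ l') i∉h)
  replace-injective _ _ (no _) (no _) eq = q-inj eq

  replace-adjacent : ∀ i i' d d' → i ≢ i' → adj G (replace i d) (replace i' d') ≡ true
  replace-adjacent _ _ (yes (l , refl)) (yes (l' , refl)) i≢i' =
    c-clique _ _ λ eq → i≢i' (cong h (Finₚ.inject₁-injective eq))
  replace-adjacent _ _ (yes (l , _)) (no i'∉h) _ = adjacent-outside (inject₁ l) i'∉h
  replace-adjacent i _ (no i∉h) (yes (l' , _)) _ =
    trans (adj-sym G (q i) _) (adjacent-outside (inject₁ l') i∉h)
  replace-adjacent i i' (no _) (no _) i≢i' = q-clique i i' i≢i'

  merged-inj : Injective _≡_ _≡_ merged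
  merged-inj {i} {i'} = replace-injective i i' (covered? i) (covered? i')

  merged-clique : ∀ i i' → i ≢ i' → adj G (merged i) (merged i') ≡ true
  merged-clique i i' = replace-adjacent i i' (covered? i) (covered? i')

  top-new : ∀ i d → replace i d ≢ c top
  top-new i (yes (l , _)) eq = Finₚ.fromℕ≢inject₁ (c-inj (sym eq))
  top-new i (no i∉h) eq = distinct-outside top i∉h (sym eq)

  top-adj : ∀ i d → adj G (c top) (replace i d) ≡ true
  top-adj i (yes (l , _)) = c-clique _ _ Finₚ.fromℕ≢inject₁
  top-adj i (no i∉h) = adjacent-outside top i∉h

injection-avoiding : {k m : ℕ} (g : Fin (suc k) → Fin m) → Injective _≡_ _≡_ g → (x : Fin m) →
  ∃ λ (ρ : Fin k → Fin (suc k)) → Injective _≡_ _≡_ ρ × (∀ i → g (ρ i) ≢ x)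
injection-avoiding g g-inj x with Finₚ.any? (λ j → g j Fin.≟ x)
... | yes (j , gj≡x) = punchIn j , Finₚ.punchIn-injective j _ _ ,
                        λ i eq → Finₚ.punchInᵢ≢i j i (g-inj (trans eq (sym gj≡x)))
... | no x∉g = suc , Finₚ.suc-injective , λ i eq → x∉g (suc i , eq)

distinct-or-covering : {w : ℕ} {P : Fin w → Set} → Decidable P → Fin w → ∀ k →
  (∃ λ (g : Fin k → Fin w) → Injective _≡_ _≡_ g × (∀ l → P (g l))) ⊎
  (∃ λ (h : Fin k → Fin w) → Covers P h)
distinct-or-covering P? pad zero = inj₁ ((λ ()) , (λ { {()} }) , λ ())
distinct-or-covering {P = P} P? pad (suc k) with distinct-or-covering P? pad k
... | inj₂ (h , covers) =
  inj₂ (pad Vector.∷ h , λ i Pi → suc (proj₁ (covers i Pi)) , proj₂ (covers i Pi))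
... | inj₁ (g , g-inj , P-g) with Finₚ.any? (λ i → P? i ×-dec ¬? (Finₚ.any? λ l → g l Fin.≟ i))
...   | yes (i , Pi , i∉g) = inj₁ (i Vector.∷ g , ∷-injective g-inj (λ l eq → i∉g (l , eq)) , P-i∷g)
  where
  P-i∷g : ∀ l → P ((i Vector.∷ g) l)
  P-i∷g zero = Pi
  P-i∷g (suc l) = P-g l
...   | no no-new = inj₂ (pad Vector.∷ g , covers)
  where
  covers : Covers P (pad Vector.∷ g)
  covers i Pi with Finₚ.any? (λ l → g l Fin.≟ i)
  ... | yes (l , gl≡i) = suc l , gl≡i
  ... | no i∉g = contradiction (i , Pi , i∉g) no-new

-- Polynomials

_+ₚ_ : Poly → Poly → Poly
[] +ₚ q = q
(a ∷ p) +ₚ [] = a ∷ p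
(a ∷ p) +ₚ (b ∷ q) = (a + b) ∷ (p +ₚ q)

eval-+ₚ : ∀ p q x → eval (p +ₚ q) x ≡ eval p x + eval q x
eval-+ₚ [] q x = refl
eval-+ₚ (a ∷ p) [] x = sym (ℕ.+-identityʳ _)
eval-+ₚ (a ∷ p) (b ∷ q) x = begin
  a + b + x * eval (p +ₚ q) x             ≡⟨ cong (λ y → a + b + x * y) (eval-+ₚ p q x) ⟩
  a + b + x * (eval p x + eval q x)       ≡⟨ regroup a b x (eval p x) (eval q x) ⟩
  a + x * eval p x + (b + x * eval q x)   ∎
  where
  open ≡-Reasoning
  regroup : ∀ a b x u v → a + b + x * (u + v) ≡ a + x * u + (b + x * v)
  regroup = solve-∀

shift : ℕ → Poly → Poly
shift zero p = p
shift (suc k) p = 0 ∷ shift k p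

eval-shift : ∀ k p x → eval (shift k p) x ≡ x ^ k * eval p x
eval-shift zero p x = sym (ℕ.+-identityʳ _)
eval-shift (suc k) p x = trans (cong (x *_) (eval-shift k p x)) (sym (ℕ.*-assoc x (x ^ k) _))

eval-mono : ∀ p {x y} → x ≤ y → eval p x ≤ eval p y
eval-mono [] x≤y = z≤n
eval-mono (a ∷ p) x≤y = ℕ.+-monoʳ-≤ a (ℕ.*-mono-≤ x≤y (eval-mono p x≤y))

maxUpTo : (ℕ → ℕ) → ℕ → ℕ
maxUpTo f zero = f zero
maxUpTo f (suc k) = f (suc k) ⊔ maxUpTo f k

≤-maxUpTo : ∀ f {j k} → j ≤ k → f j ≤ maxUpTo f k
≤-maxUpTo f {k = zero} z≤n = ℕ.≤-refl
≤-maxUpTo f {k = suc k} j≤1+k with ℕ.m≤n⇒m<n∨m≡n j≤1+k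
... | inj₂ refl = ℕ.m≤m⊔n _ _
... | inj₁ (s≤s j≤k) = ℕ.≤-trans (≤-maxUpTo f j≤k) (ℕ.m≤n⊔m _ _)

-- The maximum of f up to t + 1 rather than f (t + 1), since f need not be monotone.
χ-poly : ℕ → Poly → (ℕ → ℕ) → Poly
χ-poly t p f = shift t (r +ₚ (0 ∷ r))
  where r = p +ₚ (maxUpTo f (suc t) ∷ [])

eval-χ-poly : ∀ t p f x → eval (χ-poly t p f) x ≡ (x ^ t + x ^ suc t) * (eval p x + maxUpTo f (suc t))
eval-χ-poly t p f x = begin
  eval (shift t (r +ₚ (0 ∷ r))) x           ≡⟨ eval-shift t _ x ⟩
  x ^ t * eval (r +ₚ (0 ∷ r)) x             ≡⟨ cong (x ^ t *_) (eval-+ₚ r (0 ∷ r) x) ⟩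
  x ^ t * (eval r x + x * eval r x)         ≡⟨ factor (x ^ t) x (eval r x) ⟩
  (x ^ t + x * x ^ t) * eval r x            ≡⟨ cong ((x ^ t + x ^ suc t) *_) eval-r ⟩
  (x ^ t + x ^ suc t) * (eval p x + F)      ∎
  where
  open ≡-Reasoning
  F = maxUpTo f (suc t)
  r = p +ₚ (F ∷ [])
  factor : ∀ a x u → a * (u + x * u) ≡ (a + x * a) * u
  factor = solve-∀
  eval-r : eval r x ≡ eval p x + F
  eval-r = trans (eval-+ₚ p (F ∷ []) x)
                 (cong (eval p x +_) (trans (cong (F +_) (ℕ.*-zeroʳ x)) (ℕ.+-identityʳ F)))

-- The coloring

module Coloring
  (t : ℕ) (H G : Graph) (p : Poly) (f : ℕ → ℕ)
  (free : Free (K t ∪ᴳ H) G)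
  (bound-H-free : ∀ S → S ≤ind G → Free H S → ChiLeq S (eval p))
  (bound : ∀ S → S ≤ind G → ChiLeq S f)
  {w : ℕ} (ω-G : IsCliqueNumber G w) (pad : Fin w)
  where

  Q : Fin w → Fin (n G)
  Q = proj₁ (proj₁ ω-G)

  Q-clique : IsClique G Q
  Q-clique = proj₂ (proj₁ ω-G)

  NonNeighbour : Fin (n G) → Fin w → Set
  NonNeighbour x i = adj G x (Q i) ≡ false

  Far : Fin (n G) → (Fin t → Fin w) → Set
  Far x g = Injective _≡_ _≡_ g × (∀ i → NonNeighbour x (g i)) × (∀ i → Q (g i) ≢ x)

  Near : Fin (n G) → (Fin (suc t) → Fin w) → Set
  Near x h = Covers (NonNeighbour x) h

  Far-resp-≗ : ∀ x {g g'} → g ≗ g' → Far x g → Far x g'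
  Far-resp-≗ x {g} {g'} g≗g' (g-inj , non-adj , distinct) =
    (λ {i} {j} eq → g-inj (trans (g≗g' i) (trans eq (sym (g≗g' j))))) ,
    (λ i → subst (NonNeighbour x) (g≗g' i) (non-adj i)) ,
    (λ i → subst (λ k → Q k ≢ x) (g≗g' i) (distinct i))

  Near-resp-≗ : ∀ x {h h'} → h ≗ h' → Near x h → Near x h'
  Near-resp-≗ x h≗h' covers i non-adj =
    proj₁ (covers i non-adj) , trans (sym (h≗h' _)) (proj₂ (covers i non-adj))

  -- Q (g i) may be x itself, which is a non-neighbour by irreflexivity; dropping it leaves t indices.
  far-or-near : ∀ x → ∃ (Far x) ⊎ ∃ (Near x)
  far-or-near x with distinct-or-covering (λ i → adj G x (Q i) Bool.≟ false) pad (suc t)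
  ... | inj₂ near = inj₂ near
  ... | inj₁ (g , g-inj , non-adj) with injection-avoiding (Q ∘ g) (g-inj ∘ proj₁ Q-clique) x
  ...   | ρ , ρ-inj , distinct = inj₁ (g ∘ ρ , ρ-inj ∘ g-inj , non-adj ∘ ρ , distinct)

  NA NB : ℕ
  NA = w ^ t
  NB = w ^ suc t

  kind : Fin (n G) → Fin NA ⊎ Fin NB
  kind x = [ (λ (g , _) → inj₁ (funToFin g)) , (λ (h , _) → inj₂ (funToFin h)) ]′ (far-or-near x)

  kind-far : ∀ x a → kind x ≡ inj₁ a → Far x (finToFun a)
  kind-far x a eq with far-or-near x
  ... | inj₁ (g , far) with refl ← eq = Far-resp-≗ x (sym ∘ Finₚ.finToFun-funToFin g) far

  kind-near : ∀ x b → kind x ≡ inj₂ b → Near x (finToFun b)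
  kind-near x b eq with far-or-near x
  ... | inj₂ (h , near) with refl ← eq = Near-resp-≗ x (sym ∘ Finₚ.finToFun-funToFin h) near

  open Parts G (join NA NB ∘ kind)

  kind-of-part : ∀ c i → kind (Part.member c i) ≡ splitAt NA c
  kind-of-part c i =
    trans (sym (Finₚ.splitAt-join NA NB _)) (cong (splitAt NA) (Part.member-satisfies c i))

  budget : ℕ
  budget = eval p w + maxUpTo f (suc t)

  color-far : ∀ c a → splitAt NA c ≡ inj₁ a → Colorable (part c) budget
  color-far c a c-far = Colorable-if-inhabited S λ x₀ →
    Colorable-mono S (ℕ.≤-trans (eval-mono p ω-S≤w) (ℕ.m≤m+n _ _))
      (bound-H-free S (part-≤ind c) (S-free x₀) ω-S (proj₂ (cliqueNumber S)))
    where
    S = part c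
    g = finToFun a
    ω-S = proj₁ (cliqueNumber S)
    ω-S≤w = IsCliqueNumber-≤ind {S} {G} (part-≤ind c) (proj₂ (cliqueNumber S)) ω-G

    far : ∀ i → Far (Part.member c i) g
    far i = kind-far _ a (trans (kind-of-part c i) c-far)

    S-free : Fin (n S) → Free H S
    S-free x₀ = Free-beside-clique {t} {H} {G} (Part.member-injective c)
      (Q ∘ g , IsClique-∘ G Q-clique (proj₁ (far x₀)))
      (λ i x → proj₂ (proj₂ (far x)) i)
      (λ i x → trans (adj-sym G _ _) (proj₁ (proj₂ (far x)) i))
      free

  color-near : ∀ c b → splitAt NA c ≡ inj₂ b → Colorable (part c) budget
  color-near c b c-near =
    Colorable-mono S (ℕ.≤-trans (≤-maxUpTo f ω-S≤t+1) (ℕ.m≤n+m _ _))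
      (bound S (part-≤ind c) ω-S (proj₂ (cliqueNumber S)))
    where
    S = part c
    ω-S = proj₁ (cliqueNumber S)

    near : ∀ i → Near (Part.member c i) (finToFun b)
    near i = kind-near _ b (trans (kind-of-part c i) c-near)

    no-big-clique : ¬ HasClique S (suc (suc t))
    no-big-clique (C , C-clique) =
      proj₂ ω-G (clique-exchange G Q-clique C-in-G (finToFun b) (near ∘ C))
      where
      C-in-G = proj₂ (HasClique-≤ind {S} {G} (part-≤ind c) (C , C-clique))

    ω-S≤t+1 : ω-S ≤ suc t
    ω-S≤t+1 = IsCliqueNumber-≤ S (proj₂ (cliqueNumber S)) no-big-clique

  color-part : ∀ c → Colorable (part c) budget
  color-part c with splitAt NA c in eq
  ... | inj₁ a = color-far c a eq
  ... | inj₂ b = color-near c b eq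

  colorable : Colorable G ((NA + NB) * budget)
  colorable = Colorable-by-parts color-part

χ-bound : (t : ℕ) (H G : Graph) (p : Poly) (f : ℕ → ℕ) →
  Free (K t ∪ᴳ H) G →
  (∀ S → S ≤ind G → Free H S → ChiLeq S (eval p)) →
  (∀ S → S ≤ind G → ChiLeq S f) →
  ChiLeq G (eval (χ-poly t p f))
χ-bound t H G p f free bound-H-free bound zero (_ , no-vertex-clique) =
  Colorable-empty G (no-vertex-clique ∘ vertex-clique G)
χ-bound t H G p f free bound-H-free bound (suc w) ω-G =
  subst (Colorable G) (sym (eval-χ-poly t p f (suc w)))
    (Coloring.colorable t H G p f free bound-H-free bound ω-G zero)

-- Hereditary closure

InducedIn : Class → Class
InducedIn 𝓕 X = ∃ λ G → 𝓕 G × X ≤ind G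

BoundedBy-InducedIn : (𝓕 : Class) {f : ℕ → ℕ} → BoundedBy 𝓕 f → BoundedBy (InducedIn 𝓕) f
BoundedBy-InducedIn 𝓕 bounded X (G , 𝓕G , X≤G) Y Y≤X =
  bounded G 𝓕G Y (≤ind-trans {Y} {X} {G} Y≤X X≤G)

-- The argument works for every t, including t = 0.
proposition3p1 : (t : ℕ) → 1 ≤ t → (H : Graph) →
    Pollyanna (Free H) → Pollyanna (Free (K t ∪ᴳ H))
proposition3p1 t _ H pollyanna-H 𝓕 (f , f-bounds) = χ-poly t p f , bounded
  where
  p-bounds = pollyanna-H (InducedIn 𝓕) (f , BoundedBy-InducedIn 𝓕 f-bounds)
  p = proj₁ p-bounds

  bounded : BoundedBy (Free (K t ∪ᴳ H) ∩ 𝓕) (eval (χ-poly t p f))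
  bounded G₀ (free , 𝓕G₀) G G≤G₀ = χ-bound t H G p f
    (λ K∪H≤G → free (≤ind-trans {K t ∪ᴳ H} {G} {G₀} K∪H≤G G≤G₀))
    (λ S S≤G S-free → proj₂ p-bounds S (S-free , G₀ , 𝓕G₀ , S≤G₀ S S≤G) S (≤ind-refl {S}))
    (λ S S≤G → f-bounds G₀ 𝓕G₀ S (S≤G₀ S S≤G))
    where
    S≤G₀ : ∀ S → S ≤ind G → S ≤ind G₀
    S≤G₀ S S≤G = ≤ind-trans {S} {G} {G₀} S≤G G≤G₀
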